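{- Let $\pi$ be a permutation of $[n]$ and $\rho:[n]\to\mathbb{N}$ a pile assignment function. Then $\rho$ sorts $\pi$ on stacks (i.e. the stack shuffle of $\pi$ with pile assignments $\rho$ yields the identity permutation) if and only if $$\rho(s+1)\ \ge\ \rho(s)+[\pi(s+1)>\pi(s)]\qquad\text{for all } s\in[n-1].$$
   Context: A deck of cards labelled by $[n]$ is represented by a permutation $\pi$ of $[n]$ with $\pi(s)$ the position (from the top) of label $s$; the identity permutation is the sorted deck. In a pile shuffle, label $s$ is dealt to the $\rho(s)$-th pile collected. A stack reverses the order in which cards were placed on it. Formally, the stack shuffle of $\pi$ with pile assignments $\rho$ is the unique permutation $\sigma$ of $[n]$ such that $\sigma(s)<\sigma(t)$ iff $(\rho(s),-\pi(s))<(\rho(t),-\pi(t))$ lexicographically. $\rho$ sorts $\pi$ on stacks if $\sigma$ is the identity. $[P]$ is the indicator of $P$. -}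

module Defs where

open import Data.Nat using (ℕ; _<_; _+_)
open import Data.Fin using (Fin)
import Data.Fin as F
open import Data.Fin.Permutation using (Permutation′; _⟨$⟩ʳ_)
open import Data.Product using (_×_)
open import Data.Sum using (_⊎_)
open import Relation.Binary.PropositionalEquality using (_≡_)
open import Relation.Nullary using (Dec; yes; no)
open import Function.Bundles using (_⇔_)

[_] : ∀ {a} {P : Set a} → Dec P → ℕ
[ yes _ ] = 1
[ no  _ ] = 0

-- Lexicographic strict order on keys (ρ(s), -π(s)):
-- (a , -x) < (b , -y)  iff  a < b, or a = b and y < x.
LexKeyLt : ∀ {n} → ℕ → Fin n → ℕ → Fin n → Set
LexKeyLt a x b y = (a < b) ⊎ ((a ≡ b) × (y F.< x))

IsStackShuffle : ∀ {n} → Permutation′ n → (Fin n → ℕ) → Permutation′ n → Set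
IsStackShuffle π ρ σ =
  ∀ s t → ((σ ⟨$⟩ʳ s) F.< (σ ⟨$⟩ʳ t)) ⇔ LexKeyLt (ρ s) (π ⟨$⟩ʳ s) (ρ t) (π ⟨$⟩ʳ t)

-- ρ sorts π on stacks: the stack shuffle (unique permutation above) is the identity,
-- i.e. the identity permutation satisfies the defining property of the stack shuffle.
SortsOnStacks : ∀ {n} → Permutation′ n → (Fin n → ℕ) → Set
SortsOnStacks π ρ = IsStackShuffle π ρ Data.Fin.Permutation.id

{-# OPTIONS --safe #-}
module Submission where

-- Sorting means that the key s ↦ (ρ s , -π s) is strictly increasing in the
-- lexicographic order. A map out of Fin n into a strict order is strictly
-- increasing as soon as it increases on each adjacent pair s, s + 1, and for
-- such a pair (where π s ≢ π (s + 1)) the lexicographic inequality of the keys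
-- is exactly ρ s + [ π s < π (s + 1) ] ≤ ρ (s + 1).

open import Defs
open import Data.Nat using (ℕ; suc; _≤_; _+_)
import Data.Nat as ℕ
import Data.Nat.Properties as ℕₚ
open import Data.Fin using (Fin; toℕ; _<?_; _<_; inject₁)
import Data.Fin as Fin
open import Data.Fin.Properties using (<⇒≢; ≤∧≢⇒<; <-cmp; <-irrefl; <-asym; <-trans; <⇒≤pred; toℕ-inject₁)
open import Data.Fin.Induction using (<-weakInduction-startingFrom)
open import Data.Fin.Permutation using (Permutation′; _⟨$⟩ʳ_)
open import Data.Product using (_×_; _,_)
open import Data.Product.Relation.Binary.Lex.Strict using (×-Lex; ×-transitive; ×-asymmetric)
open import Data.Sum using (inj₁; inj₂)
open import Function using (_∘_; flip)
open import Function.Bundles using (_⇔_; mk⇔; Equivalence; Injection)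
open import Function.Properties.Inverse using (↔⇒↣)
open import Relation.Binary.Core using (Rel; _Preserves_⟶_)
open import Relation.Binary.Definitions using (Transitive; Asymmetric; tri<; tri≈; tri>)
open import Relation.Binary.PropositionalEquality using (_≡_; _≢_; refl; sym; trans; cong; isEquivalence)
open import Relation.Nullary using (yes; no; contradiction)

Adjacent : ∀ {n} → Fin n → Fin n → Set
Adjacent s s′ = toℕ s′ ≡ suc (toℕ s)

adjacent⇒< : ∀ {n} {s s′ : Fin n} → Adjacent s s′ → s < s′
adjacent⇒< adj = ℕₚ.≤-reflexive (sym adj)

module _ {a ℓ} {A : Set a} {_≺_ : Rel A ℓ} where

  adjacent⇒preserves-< : Transitive _≺_ → ∀ {n} (f : Fin n → A) →
                         (∀ {s s′} → Adjacent s s′ → f s ≺ f s′) → f Preserves _<_ ⟶ _≺_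
  adjacent⇒preserves-< ≺-trans {suc n} f step {s} {t} s<t =
    <-weakInduction-startingFrom P (λ s<s → contradiction s<s (<-irrefl refl)) extend (ℕₚ.<⇒≤ s<t) s<t
    where
    P : Fin (suc n) → Set ℓ
    P j = s < j → f s ≺ f j

    inject₁-adjacent : ∀ j → Adjacent (inject₁ j) (Fin.suc j)
    inject₁-adjacent j = cong suc (sym (toℕ-inject₁ j))

    extend : ∀ j → P (inject₁ j) → P (Fin.suc j)
    extend j ih s<1+j with ℕₚ.m≤n⇒m<n∨m≡n (<⇒≤pred s<1+j)
    ... | inj₁ s<j = ≺-trans (ih s<j) (step (inject₁-adjacent j))
    ... | inj₂ s≡j = step (trans (inject₁-adjacent j) (cong suc (sym s≡j)))

  preserves-<⇒reflects-< : Asymmetric _≺_ → ∀ {n} (f : Fin n → A) →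
                           f Preserves _<_ ⟶ _≺_ → ∀ {s t} → f s ≺ f t → s < t
  preserves-<⇒reflects-< ≺-asym f mono {s} {t} fs≺ft with <-cmp s t
  ... | tri< s<t _ _ = s<t
  ... | tri≈ _ refl _ = contradiction fs≺ft (≺-asym fs≺ft)
  ... | tri> _ _ t<s = contradiction (mono t<s) (≺-asym fs≺ft)

module _ {n : ℕ} where

  -- LexKeyLt on pairs, definitionally; as the library's lexicographic order it
  -- comes with transitivity and asymmetry.
  _≺_ : Rel (ℕ × Fin n) _
  _≺_ = ×-Lex _≡_ ℕ._<_ (flip _<_)

  ≺-trans : Transitive _≺_
  ≺-trans = ×-transitive {_<₂_ = flip _<_} isEquivalence ℕₚ.<-resp₂-≡ ℕₚ.<-trans (flip <-trans)

  ≺-asym : Asymmetric _≺_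
  ≺-asym = ×-asymmetric {_<₂_ = flip _<_} sym ℕₚ.<-resp₂-≡ ℕₚ.<-asym <-asym

  lexKeyLt⇔+[<?]≤ : ∀ {a b} {x y : Fin n} → x ≢ y →
                    LexKeyLt a x b y ⇔ (a + [ x <? y ] ≤ b)
  lexKeyLt⇔+[<?]≤ {a} {b} {x} {y} x≢y with x <? y
  ... | yes x<y rewrite ℕₚ.+-comm a 1 = mk⇔ to inj₁
    where
    to : LexKeyLt a x b y → suc a ≤ b
    to (inj₁ a<b) = a<b
    to (inj₂ (_ , y<x)) = contradiction y<x (<-asym x<y)
  ... | no x≮y rewrite ℕₚ.+-identityʳ a = mk⇔ to from
    where
    to : LexKeyLt a x b y → a ≤ b
    to (inj₁ a<b) = ℕₚ.<⇒≤ a<b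
    to (inj₂ (a≡b , _)) = ℕₚ.≤-reflexive a≡b

    from : a ≤ b → LexKeyLt a x b y
    from a≤b with ℕₚ.m≤n⇒m<n∨m≡n a≤b
    ... | inj₁ a<b = inj₁ a<b
    ... | inj₂ a≡b = inj₂ (a≡b , ≤∧≢⇒< (ℕₚ.≮⇒≥ x≮y) (x≢y ∘ sym))

lemma4 : ∀ (n : ℕ) (π : Permutation′ n) (ρ : Fin n → ℕ) →
    SortsOnStacks π ρ ⇔
      (∀ (s s′ : Fin n) → toℕ s′ ≡ suc (toℕ s) →
        ρ s + [ (π ⟨$⟩ʳ s) <? (π ⟨$⟩ʳ s′) ] ≤ ρ s′)
lemma4 n π ρ = mk⇔ sorted⇒bounded bounded⇒sorted
  where
  open Equivalence using (to; from)

  key : Fin n → ℕ × Fin n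
  key s = ρ s , π ⟨$⟩ʳ s

  AdjacentBound : Set
  AdjacentBound = ∀ s s′ → Adjacent s s′ → ρ s + [ (π ⟨$⟩ʳ s) <? (π ⟨$⟩ʳ s′) ] ≤ ρ s′

  adjacent-keys : ∀ {s s′} → Adjacent s s′ →
                  key s ≺ key s′ ⇔ (ρ s + [ (π ⟨$⟩ʳ s) <? (π ⟨$⟩ʳ s′) ] ≤ ρ s′)
  adjacent-keys adj = lexKeyLt⇔+[<?]≤ (<⇒≢ (adjacent⇒< adj) ∘ Injection.injective (↔⇒↣ π))

  sorted⇒bounded : SortsOnStacks π ρ → AdjacentBound
  sorted⇒bounded sorts s s′ adj = to (adjacent-keys adj) (to (sorts s s′) (adjacent⇒< adj))

  bounded⇒sorted : AdjacentBound → SortsOnStacks π ρ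
  bounded⇒sorted bound s t = mk⇔ increasing (preserves-<⇒reflects-< {_≺_ = _≺_} ≺-asym key increasing)
    where
    increasing : key Preserves _<_ ⟶ _≺_
    increasing = adjacent⇒preserves-< {_≺_ = _≺_} ≺-trans key (λ adj → from (adjacent-keys adj) (bound _ _ adj))
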